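{- Let $\alpha<\beta<\gamma$ be distinct primes, let $G=\langle a\rangle$ be a cyclic group of order $\alpha^2\beta^2\gamma^2$, and let $C=\{x\in G : |x|\in\{\alpha^2,\beta^2,\gamma^2\}\}$. Let $Cay_{p^2}(G,C)$ be the simple undirected graph with vertex set $G$ in which two distinct vertices $x,y$ are adjacent if and only if $xy^{ -1}\in C$. Identify $G$ with $\mathbb{Z}_{\alpha^2}\times\mathbb{Z}_{\beta^2}\times\mathbb{Z}_{\gamma^2}$ via $a^k\mapsto (k \bmod \alpha^2,\ k\bmod \beta^2,\ k\bmod\gamma^2)$. For $(i,j,k)\in\mathbb{Z}_\alpha\times\mathbb{Z}_\beta\times\mathbb{Z}_\gamma$ (with $i,j,k$ represented by integers $0\le i<\alpha$, $0\le j<\beta$, $0\le k<\gamma$), let $$C(i,j,k)=\{(i+\alpha x,\ j+\beta y,\ k+\gamma z): x\in\mathbb{Z}_\alpha,\ y\in\mathbb{Z}_\beta,\ z\in\mathbb{Z}_\gamma\},$$ where the coordinates are taken in $\mathbb{Z}_{\alpha^2},\mathbb{Z}_{\beta^2},\mathbb{Z}_{\gamma^2}$ respectively. Then $C(i,j,k)$ is an independent set of $Cay_{p^2}(G,C)$ of size $\alpha\beta\gamma$.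
   Context: $|x|$ denotes the order of the element $x$ in $G$. An independent set is a set of pairwise non-adjacent vertices. -}

module Defs where

open import Data.Nat using (ℕ; suc; _+_; _*_; _∸_; _^_; _≤_; _<_; NonZero)
open import Data.Nat.DivMod using (_%_)
open import Data.Nat.Divisibility using (_∣_)
open import Data.Nat.Properties using (m*n≢0; m^n≢0)
open import Data.Fin using (Fin; toℕ)
open import Data.Product using (Σ; ∃; _×_)
open import Data.Sum using (_⊎_)
open import Relation.Binary.PropositionalEquality using (_≡_)
open import Relation.Nullary using (¬_)

-- The cyclic group G = ⟨a⟩ of order n is modelled as ℤ_n = Fin n under
-- addition mod n, with generator a = 1; the element a^k is k mod n.

-- x y⁻¹ in additive notation: (x - y) mod n
_⊖⟨_⟩_ : (x : ℕ) (n : ℕ) .{{_ : NonZero n}} → ℕ → ℕ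
x ⊖⟨ n ⟩ y = (x + (n ∸ y)) % n

HasOrder : (n : ℕ) → ℕ → ℕ → Set
HasOrder n x d = (1 ≤ d) × (n ∣ d * x) × (∀ e → 1 ≤ e → n ∣ e * x → d ≤ e)

InC : (n α β γ : ℕ) → ℕ → Set
InC n α β γ x = HasOrder n x (α ^ 2) ⊎ HasOrder n x (β ^ 2) ⊎ HasOrder n x (γ ^ 2)

Adj : (α β γ : ℕ) .{{_ : NonZero α}} .{{_ : NonZero β}} .{{_ : NonZero γ}} →
      (x y : Fin (α ^ 2 * β ^ 2 * γ ^ 2)) → Set
Adj α β γ x y =
  ¬ (x ≡ y) × InC (α ^ 2 * β ^ 2 * γ ^ 2) α β γ (_⊖⟨_⟩_ (toℕ x) (α ^ 2 * β ^ 2 * γ ^ 2)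
      {{m*n≢0 (α ^ 2 * β ^ 2) (γ ^ 2) {{m*n≢0 (α ^ 2) (β ^ 2) {{m^n≢0 α 2}} {{m^n≢0 β 2}}}} {{m^n≢0 γ 2}}}}
      (toℕ y))

-- membership of a^g in C(i,j,k), via a^g ↦ (g mod α², g mod β², g mod γ²):
-- exists x ∈ ℤ_α, y ∈ ℤ_β, z ∈ ℤ_γ with the coordinates equal to
-- (i + α x, j + β y, k + γ z) (these values are already < α², β², γ²).
InCijk : (α β γ : ℕ) .{{_ : NonZero α}} .{{_ : NonZero β}} .{{_ : NonZero γ}} →
         Fin α → Fin β → Fin γ → Fin (α ^ 2 * β ^ 2 * γ ^ 2) → Set
InCijk α β γ i j k g =
  Σ (Fin α) λ x → Σ (Fin β) λ y → Σ (Fin γ) λ z →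
    (_%_ (toℕ g) (α * α) {{m*n≢0 α α}} ≡ toℕ i + α * toℕ x) ×
    (_%_ (toℕ g) (β * β) {{m*n≢0 β β}} ≡ toℕ j + β * toℕ y) ×
    (_%_ (toℕ g) (γ * γ) {{m*n≢0 γ γ}} ≡ toℕ k + γ * toℕ z)

{-# OPTIONS --safe #-}
module Submission where

-- An element g lies in C(i,j,k) when its residues modulo α², β², γ² are i + αx, j + βy, k + γz,
-- so g ≡ i, j, k modulo α, β, γ, and every p ∈ {α, β, γ} divides the difference d of two
-- elements of C(i,j,k). But if d has order p² in ℤ_{p²q} with p ∤ q, then p²q ∣ p²d gives q ∣ d,
-- and with p ∣ d this yields p²q ∣ pd, so the order of d would be at most p.
-- For the count, the Chinese remainder theorem (its existence half follows from uniqueness by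
-- counting) determines g by its residues modulo α², β², γ², so the elements of C(i,j,k)
-- correspond to the digit triples (x, y, z) ∈ ℤ_α × ℤ_β × ℤ_γ.

open import Defs
open import Data.Nat using (ℕ; zero; suc; _+_; _*_; _∸_; _^_; _≤_; _<_; NonZero; NonTrivial; nonTrivial⇒n>1; >-nonZero⁻¹)
open import Data.Nat.Properties
open import Data.Nat.DivMod
open import Data.Nat.Divisibility
open import Data.Nat.Coprimality using (Coprime; coprime-divisor; coprime⇒gcd≡1; prime⇒coprime)
import Data.Nat.Coprimality as Coprime
open import Data.Nat.LCM using (lcm; lcm-least; gcd*lcm)
open import Data.Nat.Primality using (Prime; prime⇒nonZero; prime⇒nonTrivial)
open import Data.Fin using (Fin; toℕ; fromℕ<; combine; punchOut)
open import Data.Fin.Properties using (toℕ<n; toℕ-fromℕ<; toℕ≤n; toℕ-injective; combine-injective; any?; pigeonhole; punchOut-injective; *↔×)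
import Data.Fin.Properties as Fin
open import Data.Product using (Σ; ∃; _×_; _,_; proj₂)
open import Data.Product.Algebra using (×-assoc)
open import Data.Product.Function.NonDependent.Propositional using (_×-↔_)
open import Data.Sum using (inj₁; inj₂)
open import Function using (_∘_)
open import Function.Bundles using (_↔_; mk↔ₛ′)
open import Function.Definitions using (Injective)
open import Function.Properties.Inverse using (↔-refl; ↔-sym; ↔-trans)
open import Level using (0ℓ)
open import Relation.Nullary using (¬_; yes; no; contradiction)
open import Relation.Binary.PropositionalEquality

private
  variable
    a b c d g h i m n o p q x : ℕ

coprime-*ʳ : Coprime m n → Coprime m o → Coprime m (n * o)
coprime-*ʳ m⊥n m⊥o (d∣m , d∣no) =
  m⊥o (d∣m , coprime-divisor (λ (e∣d , e∣n) → m⊥n (∣-trans e∣d d∣m , e∣n)) d∣no)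

coprime-*ˡ : Coprime m o → Coprime n o → Coprime (m * n) o
coprime-*ˡ m⊥o n⊥o = Coprime.sym (coprime-*ʳ (Coprime.sym m⊥o) (Coprime.sym n⊥o))

coprime-^ʳ : ∀ k → Coprime m n → Coprime m (n ^ k)
coprime-^ʳ zero    _   (_ , d∣1) = ∣1⇒≡1 d∣1
coprime-^ʳ (suc k) m⊥n = coprime-*ʳ m⊥n (coprime-^ʳ k m⊥n)

coprime-square : Coprime m n → Coprime (m * m) (n * n)
coprime-square m⊥n = coprime-*ˡ (coprime-*ʳ m⊥n m⊥n) (coprime-*ʳ m⊥n m⊥n)

coprime⇒*∣ : Coprime m n → m ∣ o → n ∣ o → m * n ∣ o
coprime⇒*∣ {m} {n} m⊥n m∣o n∣o = subst (_∣ _) lcm≡m*n (lcm-least m∣o n∣o)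
  where
  lcm≡m*n : lcm m n ≡ m * n
  lcm≡m*n = trans (sym (*-identityˡ (lcm m n)))
                  (trans (cong (_* lcm m n) (sym (coprime⇒gcd≡1 m⊥n))) (gcd*lcm m n))

<-prime⇒coprime : Prime p → Prime q → p < q → Coprime p q
<-prime⇒coprime pp pq p<q = Coprime.sym (prime⇒coprime pq {{prime⇒nonZero pp}} p<q)

%≡%⇒∣∸ : .{{_ : NonZero n}} → a % n ≡ b % n → n ∣ b ∸ a
%≡%⇒∣∸ {n} {a} {b} e = divides (b / n ∸ a / n) (begin
  b ∸ a                                     ≡⟨ cong₂ _∸_ (m≡m%n+[m/n]*n b n) (m≡m%n+[m/n]*n a n) ⟩
  (b % n + b / n * n) ∸ (a % n + a / n * n) ≡⟨ cong (λ r → (b % n + b / n * n) ∸ (r + a / n * n)) e ⟩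
  (b % n + b / n * n) ∸ (b % n + a / n * n) ≡⟨ [m+n]∸[m+o]≡n∸o (b % n) _ _ ⟩
  b / n * n ∸ a / n * n                     ≡⟨ *-distribʳ-∸ n (b / n) (a / n) ⟨
  (b / n ∸ a / n) * n                       ∎)
  where open ≡-Reasoning

∣∸⇒%≡% : .{{_ : NonZero n}} → a ≤ b → n ∣ b ∸ a → a % n ≡ b % n
∣∸⇒%≡% {n} {a} {b} a≤b n∣b∸a = begin
  a % n             ≡⟨ %-remove-+ʳ a n∣b∸a ⟨
  (a + (b ∸ a)) % n ≡⟨ %-congˡ (m+[n∸m]≡n a≤b) ⟩
  b % n             ∎
  where open ≡-Reasoning

%≡%⇒≡ : .{{_ : NonZero n}} → a < n → b < n → a % n ≡ b % n → a ≡ b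
%≡%⇒≡ a<n b<n e = trans (sym (m<n⇒m%n≡m a<n)) (trans e (m<n⇒m%n≡m b<n))

crt-unique : .{{_ : NonZero m}} .{{_ : NonZero n}} .{{_ : NonZero (m * n)}} → Coprime m n →
        a % m ≡ b % m → a % n ≡ b % n → a % (m * n) ≡ b % (m * n)
crt-unique {a = a} {b} m⊥n e₁ e₂ with ≤-total a b
... | inj₁ a≤b = ∣∸⇒%≡% a≤b (coprime⇒*∣ m⊥n (%≡%⇒∣∸ e₁) (%≡%⇒∣∸ e₂))
... | inj₂ b≤a = sym (∣∸⇒%≡% b≤a (coprime⇒*∣ m⊥n (%≡%⇒∣∸ (sym e₁)) (%≡%⇒∣∸ (sym e₂))))

injective⇒surjective : (f : Fin n → Fin n) → Injective _≡_ _≡_ f → ∀ y → ∃ λ x → f x ≡ y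
injective⇒surjective {suc n} f f-inj y with any? (λ x → f x Fin.≟ y)
... | yes hit = hit
... | no miss
  with i , j , i<j , fᵢ≡fⱼ ← pigeonhole (n<1+n n) (λ x → punchOut (miss ∘ (x ,_) ∘ sym))
  = contradiction (f-inj (punchOut-injective (miss ∘ (i ,_) ∘ sym) (miss ∘ (j ,_) ∘ sym) fᵢ≡fⱼ)) (Fin.<⇒≢ i<j)

mod≡mod⇒%≡% : .{{_ : NonZero n}} → a mod n ≡ b mod n → a % n ≡ b % n
mod≡mod⇒%≡% {n} {a} {b} e = trans (sym (toℕ-fromℕ< (m%n<n a n))) (trans (cong toℕ e) (toℕ-fromℕ< (m%n<n b n)))

crt-∃ : .{{_ : NonZero m}} .{{_ : NonZero n}} → Coprime m n → a < m → b < n →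
        ∃ λ r → r < m * n × r % m ≡ a × r % n ≡ b
crt-∃ {m} {n} {a} {b} m⊥n a<m b<n =
  let r , fr≡ab = injective⇒surjective residues residues-injective (combine (a mod m) (b mod n))
      ra , rb   = combine-injective _ _ _ _ fr≡ab
  in  toℕ r , toℕ<n r , trans (mod≡mod⇒%≡% ra) (m<n⇒m%n≡m a<m) , trans (mod≡mod⇒%≡% rb) (m<n⇒m%n≡m b<n)
  where
  instance
    m*n≢0′ : NonZero (m * n)
    m*n≢0′ = m*n≢0 m n

  residues : Fin (m * n) → Fin (m * n)
  residues r = combine (toℕ r mod m) (toℕ r mod n)

  residues-injective : Injective _≡_ _≡_ residues
  residues-injective {r} {s} e =
    let rs₁ , rs₂ = combine-injective _ _ _ _ e
    in  toℕ-injective (%≡%⇒≡ (toℕ<n r) (toℕ<n s) (crt-unique m⊥n (mod≡mod⇒%≡% rs₁) (mod≡mod⇒%≡% rs₂)))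

crt₃-∃ : .{{_ : NonZero m}} .{{_ : NonZero n}} .{{_ : NonZero o}} →
         Coprime m n → Coprime (m * n) o → a < m → b < n → c < o →
         ∃ λ r → r < m * n * o × r % m ≡ a × r % n ≡ b × r % o ≡ c
crt₃-∃ {m} {n} {o} m⊥n mn⊥o a<m b<n c<o =
  let s , s<mn , s%m , s%n = crt-∃ m⊥n a<m b<n
      r , r<mno , r%mn , r%o = crt-∃ mn⊥o s<mn c<o
  in  r , r<mno , via r%mn s%m (m∣m*n n) , via r%mn s%n (n∣m*n m) , r%o
  where
  instance
    m*n≢0′ : NonZero (m * n)
    m*n≢0′ = m*n≢0 m n

  via : ∀ {r s t d} .{{_ : NonZero d}} → r % (m * n) ≡ s → s % d ≡ t → d ∣ m * n → r % d ≡ t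
  via {r} {d = d} r%mn s%d d∣mn = trans (sym (m∣n⇒o%n%m≡o%m d (m * n) r d∣mn)) (trans (%-congˡ r%mn) s%d)

%≡%⇒∣⊖ : .{{_ : NonZero p}} .{{_ : NonZero n}} → p ∣ n → h ≤ n → g % p ≡ h % p → p ∣ g ⊖⟨ n ⟩ h
%≡%⇒∣⊖ {p} {n} {h} {g} p∣n h≤n e = %-presˡ-∣ (m%n≡0⇒n∣m _ p (begin
  (g + (n ∸ h)) % p             ≡⟨ %-distribˡ-+ g (n ∸ h) p ⟩
  (g % p + (n ∸ h) % p) % p     ≡⟨ cong (λ r → (r + (n ∸ h) % p) % p) e ⟩
  (h % p + (n ∸ h) % p) % p     ≡⟨ %-distribˡ-+ h (n ∸ h) p ⟨
  (h + (n ∸ h)) % p             ≡⟨ %-congˡ (m+[n∸m]≡n h≤n) ⟩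
  n % p                         ≡⟨ n∣m⇒m%n≡0 n p p∣n ⟩
  0                             ∎)) p∣n
  where open ≡-Reasoning

p∣d⇒¬HasOrder[p²] : Prime p → Coprime p q → n ≡ p ^ 2 * q → p ∣ d → ¬ HasOrder n d (p ^ 2)
p∣d⇒¬HasOrder[p²] {p} {q} {d = d} pp p⊥q refl p∣d (_ , n∣p²d , least) =
  <⇒≱ p<p² (least p (>-nonZero⁻¹ p) n∣pd)
  where
  instance
    p≢0 : NonZero p
    p≢0 = prime⇒nonZero pp

    p>1 : NonTrivial p
    p>1 = prime⇒nonTrivial pp

    p²≢0 : NonZero (p ^ 2)
    p²≢0 = m^n≢0 p 2

  q∣d : q ∣ d
  q∣d = *-cancelˡ-∣ (p ^ 2) n∣p²d

  p^2*q≡p*[p*q] : p ^ 2 * q ≡ p * (p * q)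
  p^2*q≡p*[p*q] = trans (cong (λ t → p * t * q) (*-identityʳ p)) (*-assoc p p q)

  n∣pd : p ^ 2 * q ∣ p * d
  n∣pd = subst (_∣ p * d) (sym p^2*q≡p*[p*q]) (*-monoʳ-∣ p (coprime⇒*∣ p⊥q p∣d q∣d))

  p<p² : p < p ^ 2
  p<p² = m<m*n p (p * 1) (subst (1 <_) (sym (*-identityʳ p)) (nonTrivial⇒n>1 p))

%≡%⇒¬HasOrder[p²] : .{{_ : NonZero p}} .{{_ : NonZero n}} → Prime p → Coprime p q → n ≡ p ^ 2 * q →
                    h ≤ n → g % p ≡ h % p → ¬ HasOrder n (g ⊖⟨ n ⟩ h) (p ^ 2)
%≡%⇒¬HasOrder[p²] {p} {n} {q} pp p⊥q n≡p²q h≤n e =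
  p∣d⇒¬HasOrder[p²] pp p⊥q n≡p²q (%≡%⇒∣⊖ p∣n h≤n e)
  where
  p∣n : p ∣ n
  p∣n = subst (p ∣_) (sym n≡p²q) (∣m⇒∣m*n q (m∣m*n (p ^ 1)))

%[p*p]≡i+p*x⇒%p≡i : .{{_ : NonZero p}} .{{_ : NonZero (p * p)}} → i < p → g % (p * p) ≡ i + p * x → g % p ≡ i
%[p*p]≡i+p*x⇒%p≡i {p} {i} {g} {x} i<p e = begin
  g % p               ≡⟨ m∣n⇒o%n%m≡o%m p (p * p) g (m∣m*n p) ⟨
  g % (p * p) % p     ≡⟨ %-congˡ e ⟩
  (i + p * x) % p     ≡⟨ %-congˡ (cong (i +_) (*-comm p x)) ⟩
  (i + x * p) % p     ≡⟨ [m+kn]%n≡m%n i x p ⟩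
  i % p               ≡⟨ m<n⇒m%n≡m i<p ⟩
  i                   ∎
  where open ≡-Reasoning

i<p⇒x<p⇒i+p*x<p*p : i < p → x < p → i + p * x < p * p
i<p⇒x<p⇒i+p*x<p*p {i} {p} {x} i<p x<p = begin-strict
  i + p * x       <⟨ +-monoˡ-< (p * x) i<p ⟩
  p + p * x       ≡⟨ *-suc p x ⟨
  p * suc x     ≤⟨ *-monoʳ-≤ p x<p ⟩
  p * p           ∎
  where open ≤-Reasoning

*↔×₃ : Fin (m * n * o) ↔ (Fin m × Fin n × Fin o)
*↔×₃ {m} {n} {o} = ↔-trans *↔× (↔-trans (*↔× ×-↔ ↔-refl) (×-assoc 0ℓ (Fin m) (Fin n) (Fin o)))

module _ {α β γ : ℕ} (pα : Prime α) (pβ : Prime β) (pγ : Prime γ) (α<β : α < β) (β<γ : β < γ)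
         .{{_ : NonZero α}} .{{_ : NonZero β}} .{{_ : NonZero γ}}
         (i : Fin α) (j : Fin β) (k : Fin γ) where

  private
    N : ℕ
    N = α ^ 2 * β ^ 2 * γ ^ 2

    instance
      α*α≢0 : NonZero (α * α)
      α*α≢0 = m*n≢0 α α

      β*β≢0 : NonZero (β * β)
      β*β≢0 = m*n≢0 β β

      γ*γ≢0 : NonZero (γ * γ)
      γ*γ≢0 = m*n≢0 γ γ

      α²β²≢0 : NonZero (α * α * (β * β))
      α²β²≢0 = m*n≢0 (α * α) (β * β)

      α²β²γ²≢0 : NonZero (α * α * (β * β) * (γ * γ))
      α²β²γ²≢0 = m*n≢0 (α * α * (β * β)) (γ * γ)

      N≢0 : NonZero N
      N≢0 = m*n≢0 (α ^ 2 * β ^ 2) (γ ^ 2) {{m*n≢0 (α ^ 2) (β ^ 2) {{m^n≢0 α 2}} {{m^n≢0 β 2}}}} {{m^n≢0 γ 2}}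

    α⊥β : Coprime α β
    α⊥β = <-prime⇒coprime pα pβ α<β

    α⊥γ : Coprime α γ
    α⊥γ = <-prime⇒coprime pα pγ (<-trans α<β β<γ)

    β⊥γ : Coprime β γ
    β⊥γ = <-prime⇒coprime pβ pγ β<γ

    N≡α²[β²γ²] : N ≡ α ^ 2 * (β ^ 2 * γ ^ 2)
    N≡α²[β²γ²] = *-assoc (α ^ 2) (β ^ 2) (γ ^ 2)

    N≡β²[α²γ²] : N ≡ β ^ 2 * (α ^ 2 * γ ^ 2)
    N≡β²[α²γ²] = trans (cong (_* γ ^ 2) (*-comm (α ^ 2) (β ^ 2))) (*-assoc (β ^ 2) (α ^ 2) (γ ^ 2))

    N≡γ²[α²β²] : N ≡ γ ^ 2 * (α ^ 2 * β ^ 2)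
    N≡γ²[α²β²] = *-comm (α ^ 2 * β ^ 2) (γ ^ 2)

    α⊥β²γ² : Coprime α (β ^ 2 * γ ^ 2)
    α⊥β²γ² = coprime-*ʳ (coprime-^ʳ 2 α⊥β) (coprime-^ʳ 2 α⊥γ)

    β⊥α²γ² : Coprime β (α ^ 2 * γ ^ 2)
    β⊥α²γ² = coprime-*ʳ (coprime-^ʳ 2 (Coprime.sym α⊥β)) (coprime-^ʳ 2 β⊥γ)

    γ⊥α²β² : Coprime γ (α ^ 2 * β ^ 2)
    γ⊥α²β² = coprime-*ʳ (coprime-^ʳ 2 (Coprime.sym α⊥γ)) (coprime-^ʳ 2 (Coprime.sym β⊥γ))

    same-residue : ∀ {p} .{{_ : NonZero p}} .{{_ : NonZero (p * p)}} {g h x y} (l : Fin p) →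
                   g % (p * p) ≡ toℕ l + p * x → h % (p * p) ≡ toℕ l + p * y → g % p ≡ h % p
    same-residue l g≡ h≡ = trans (%[p*p]≡i+p*x⇒%p≡i (toℕ<n l) g≡) (sym (%[p*p]≡i+p*x⇒%p≡i (toℕ<n l) h≡))

    N≡[α*α]*[β*β]*[γ*γ] : N ≡ α * α * (β * β) * (γ * γ)
    N≡[α*α]*[β*β]*[γ*γ] = cong₂ _*_ (cong₂ _*_ (square α) (square β)) (square γ)
      where
      square : ∀ p → p ^ 2 ≡ p * p
      square p = cong (p *_) (*-identityʳ p)

    α²⊥β² : Coprime (α * α) (β * β)
    α²⊥β² = coprime-square α⊥β

    α²β²⊥γ² : Coprime (α * α * (β * β)) (γ * γ)
    α²β²⊥γ² = coprime-*ˡ (coprime-square α⊥γ) (coprime-square β⊥γ)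

    HasDigits : Fin N → Fin α → Fin β → Fin γ → Set
    HasDigits g x y z = (toℕ g % (α * α) ≡ toℕ i + α * toℕ x) ×
                        (toℕ g % (β * β) ≡ toℕ j + β * toℕ y) ×
                        (toℕ g % (γ * γ) ≡ toℕ k + γ * toℕ z)

    digits-∃ : ∀ x y z → ∃ λ g → HasDigits g x y z
    digits-∃ x y z =
      let r , r<M , rα , rβ , rγ = crt₃-∃ α²⊥β² α²β²⊥γ² (digit< i x) (digit< j y) (digit< k z)
          r<N = subst (r <_) (sym N≡[α*α]*[β*β]*[γ*γ]) r<M
          at : ∀ d {t} .{{_ : NonZero d}} → r % d ≡ t → toℕ (fromℕ< r<N) % d ≡ t
          at d = trans (%-congˡ (toℕ-fromℕ< r<N))
      in  fromℕ< r<N , at (α * α) rα , at (β * β) rβ , at (γ * γ) rγ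
      where
      digit< : ∀ {p} (l x : Fin p) → toℕ l + p * toℕ x < p * p
      digit< l x = i<p⇒x<p⇒i+p*x<p*p (toℕ<n l) (toℕ<n x)

    digits-unique : ∀ {g h x y z} → HasDigits g x y z → HasDigits h x y z → g ≡ h
    digits-unique {g} {h} (gα , gβ , gγ) (hα , hβ , hγ) =
      toℕ-injective (%≡%⇒≡ (<M g) (<M h)
        (crt-unique α²β²⊥γ² (crt-unique α²⊥β² (trans gα (sym hα)) (trans gβ (sym hβ))) (trans gγ (sym hγ))))
      where
      <M : (g : Fin N) → toℕ g < α * α * (β * β) * (γ * γ)
      <M g = subst (toℕ g <_) N≡[α*α]*[β*β]*[γ*γ] (toℕ<n g)

    digits-irrelevant : ∀ {g x y z} (d e : HasDigits g x y z) → d ≡ e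
    digits-irrelevant (d₁ , d₂ , d₃) (e₁ , e₂ , e₃) =
      cong₂ _,_ (≡-irrelevant d₁ e₁) (cong₂ _,_ (≡-irrelevant d₂ e₂) (≡-irrelevant d₃ e₃))

    same-digits⇒≡ : ∀ {g h x y z} (d : HasDigits g x y z) (e : HasDigits h x y z) →
                    _≡_ {A = Σ (Fin N) (InCijk α β γ i j k)} (g , x , y , z , d) (h , x , y , z , e)
    same-digits⇒≡ d e with refl ← digits-unique d e = cong (λ e → _ , _ , _ , _ , e) (digits-irrelevant d e)

  C[i,j,k]-independent : (g h : Fin N) → InCijk α β γ i j k g → InCijk α β γ i j k h → ¬ Adj α β γ g h
  C[i,j,k]-independent g h (_ , _ , _ , gα , _ , _) (_ , _ , _ , hα , _ , _) (_ , inj₁ ord) =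
    %≡%⇒¬HasOrder[p²] pα α⊥β²γ² N≡α²[β²γ²] (toℕ≤n h) (same-residue i gα hα) ord
  C[i,j,k]-independent g h (_ , _ , _ , _ , gβ , _) (_ , _ , _ , _ , hβ , _) (_ , inj₂ (inj₁ ord)) =
    %≡%⇒¬HasOrder[p²] pβ β⊥α²γ² N≡β²[α²γ²] (toℕ≤n h) (same-residue j gβ hβ) ord
  C[i,j,k]-independent g h (_ , _ , _ , _ , _ , gγ) (_ , _ , _ , _ , _ , hγ) (_ , inj₂ (inj₂ ord)) =
    %≡%⇒¬HasOrder[p²] pγ γ⊥α²β² N≡γ²[α²β²] (toℕ≤n h) (same-residue k gγ hγ) ord

  C[i,j,k]↔digits : Σ (Fin N) (InCijk α β γ i j k) ↔ (Fin α × Fin β × Fin γ)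
  C[i,j,k]↔digits = mk↔ₛ′ digits point (λ _ → refl) point-digits
    where
    digits : Σ (Fin N) (InCijk α β γ i j k) → Fin α × Fin β × Fin γ
    digits (_ , x , y , z , _) = x , y , z

    point : Fin α × Fin β × Fin γ → Σ (Fin N) (InCijk α β γ i j k)
    point (x , y , z) = let g , e = digits-∃ x y z in g , x , y , z , e

    point-digits : ∀ c → point (digits c) ≡ c
    point-digits (g , x , y , z , e) = same-digits⇒≡ (proj₂ (digits-∃ x y z)) e

proposition2p9 : (α β γ : ℕ) → Prime α → Prime β → Prime γ → α < β → β < γ →
    .{{_ : NonZero α}} → .{{_ : NonZero β}} → .{{_ : NonZero γ}} →
    (i : Fin α) (j : Fin β) (k : Fin γ) →
    ((g h : Fin (α ^ 2 * β ^ 2 * γ ^ 2)) →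
      InCijk α β γ i j k g → InCijk α β γ i j k h → ¬ Adj α β γ g h) ×
    ((Σ (Fin (α ^ 2 * β ^ 2 * γ ^ 2)) (InCijk α β γ i j k)) ↔ Fin (α * β * γ))
proposition2p9 α β γ pα pβ pγ α<β β<γ i j k =
  C[i,j,k]-independent pα pβ pγ α<β β<γ i j k ,
  ↔-trans (C[i,j,k]↔digits pα pβ pγ α<β β<γ i j k) (↔-sym *↔×₃)
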